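{- Let $n\geq 2$ and let $r$ be such that $1\leq r<\frac{n}{2}$ and $\gcd(r,n)=1$, and suppose that $\frac rn$ has extended binary sequence $\sigma_1\cdots\sigma_\ell 1=1\sigma_2\cdots\sigma_\ell 1$, with $\ell=\operatorname{depth}\left(\frac rn\right)-1$. Let $(n_1^{k_1},n_2^{k_2})$ be a partition of $n$ in the $m$-th generation of the orbit of partitions generated by $\frac rn$, that is, suppose there is $1\leq m\leq \ell$ such that \[ \begin{pmatrix} r\\ n\end{pmatrix}=\prod_{j=1}^{m}\Phi_{\sigma_j}\begin{pmatrix} n_2\\ n_1\end{pmatrix}=\begin{pmatrix} t & s\\ k_2 & k_1\end{pmatrix}\begin{pmatrix} n_2\\ n_1\end{pmatrix}. \] Then the conjugate partition $(\tilde n_1^{\tilde k_1},\tilde n_2^{\tilde k_2})$, where $\tilde n_1=k_1+k_2$, $\tilde n_2=k_1$, $\tilde k_1=n_2$, $\tilde k_2=n_1-n_2$, is in the $(\ell+1-m)$-th generation of the orbit of partitions generated by $\frac{\tilde r}{n}$, where $\frac{\tilde r}{n}$ is the fraction with extended binary sequence $\tilde\sigma_1\cdots\tilde\sigma_\ell 1:=1\sigma_\ell\cdots\sigma_2 1$ (the reversal of $\sigma_1\cdots\sigma_\ell 1$). In other words, \[ \begin{pmatrix} \tilde r\\ n\end{pmatrix}=\prod_{j=1}^{\ell+1-m}\Phi_{\tilde\sigma_j}\begin{pmatrix} \tilde n_2\\ \tilde n_1\end{pmatrix}=\begin{pmatrix} \tilde t & \tilde s\\ \tilde k_2 & \tilde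 k_1\end{pmatrix}\begin{pmatrix} \tilde n_2\\ \tilde n_1\end{pmatrix}. \] Moreover, the continued fraction expansion of $\frac{\tilde r}{n}$ has the same digits as that of $\frac rn$, but in reversed order: $\frac rn=[a_1,\ldots,a_k]$ iff $\frac{\tilde r}{n}=[a_k,\ldots,a_1]$.
   Context: The Farey map $F$ on $[0,1]$ is $F(x)=\frac{1-x}{x}$ on $[\frac12,1]$ and $F(x)=\frac{x}{1-x}$ on $[0,\frac12]$, with inverse branches given (acting on column vectors $(p,q)^\top$ representing $p/q$) by the matrices $\Phi_0=\begin{pmatrix}0&1\\1&1\end{pmatrix}$ and $\Phi_1=\begin{pmatrix}1&0\\1&1\end{pmatrix}$. The Farey tree has root $\frac12$, and the children of $\frac pq$ are $\frac{p}{p+q}$ and $\frac{q}{p+q}$; it contains every rational in $(0,1)$ exactly once in lowest terms. The level $\mathcal L_k$ is $F^{ -k+1}(\frac12)$, and $\operatorname{depth}(\frac pq)=k$ iff $\frac pq\in\mathcal L_k$. The binary sequence $\sigma(x)=\sigma_1\sigma_2\cdots$ is defined by $F^{j-1}(x)\in(\frac12,1)$ if $\sigma_j=0$ and $F^{j-1}(x)\in(0,\frac12)$ if $\sigma_j=1$, stopping when the image is $\frac12$; for rational $\frac rn$ it has length $\ell=\operatorname{depth}(\frac rn)-1$, and $(r,n)^\top=\prod_{j=1}^{\ell}\Phi_{\sigma_j}(1,2)^\top=\prod_{j=1}^{\ell+1}\Phi_{\sigma_j}(1,1)^\top$ with $\sigma_{\ell+1}\in\{0,1\}$. Choosing $\sigma_{\ell+1}=1$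 gives the extended binary sequence $\sigma_1\cdots\sigma_\ell 1$. For each $m$, writing $(r,n)^\top=\prod_{j=1}^m\Phi_{\sigma_j}\cdot\prod_{j=m+1}^{\ell+1}\Phi_{\sigma_j}(1,1)^\top$ with $\prod_{j=1}^m\Phi_{\sigma_j}=\begin{pmatrix}h_2&h_1\\k_2&k_1\end{pmatrix}$ and $\prod_{j=m+1}^{\ell+1}\Phi_{\sigma_j}(1,1)^\top=(n_2,n_1)^\top$ gives a partition $n=k_1n_1+k_2n_2$, written $(n_1^{k_1},n_2^{k_2})$ (parts $n_1\geq n_2$ with multiplicities $k_1,k_2$), of generation $m$; for $m=1,\ldots,\ell$ these form the orbit of partitions generated by $\frac rn$. The conjugate partition is obtained by flipping the Young shape (rows into columns), and $(n_1^{k_1},n_2^{k_2})$ is conjugate to $((k_1+k_2)^{n_2},k_1^{n_1-n_2})$. -}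

module Defs where

open import Data.Nat using (ℕ; zero; suc; _+_; _*_; _∸_; _<_; NonZero)
open import Data.Nat.Properties using (<-cmp)
open import Data.Nat.DivMod using (_/_; _%_)
open import Data.Product using (_×_; _,_)
open import Data.List using (List; []; _∷_)
open import Relation.Binary.Definitions using (tri<; tri≈; tri>)

data Bit : Set where
  b0 b1 : Bit

record Mat : Set where
  constructor mat
  field
    e11 e12 e21 e22 : ℕ

_⊗_ : Mat → Mat → Mat
mat a b c d ⊗ mat a' b' c' d' =
  mat (a * a' + b * c') (a * b' + b * d') (c * a' + d * c') (c * b' + d * d')

act : Mat → ℕ × ℕ → ℕ × ℕ
act (mat a b c d) (p , q) = (a * p + b * q , c * p + d * q)

-- inverse branches of the Farey map
Φ : Bit → Mat
Φ b0 = mat 0 1 1 1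
Φ b1 = mat 1 0 1 1

prodΦ : List Bit → Mat
prodΦ []       = mat 1 0 0 1
prodΦ (b ∷ bs) = Φ b ⊗ prodΦ bs

-- Binary sequence of p/q by iterating the Farey map on the pair (p,q):
-- F(p/q) = (q-p)/p  (digit 0) if p/q ∈ (1/2,1),
-- F(p/q) = p/(q-p)  (digit 1) if p/q ∈ (0,1/2),
-- stopping when the image is 1/2.  The first argument is fuel.
binSeq : ℕ → ℕ → ℕ → List Bit
binSeq zero    p q = []
binSeq (suc f) p q with <-cmp (2 * p) q
... | tri< _ _ _ = b1 ∷ binSeq f p (q ∸ p)
... | tri≈ _ _ _ = []
... | tri> _ _ _ = b0 ∷ binSeq f (q ∸ p) p

-- the binary sequence σ(p/q); fuel q suffices since denominators strictly decrease
binarySeq : ℕ → ℕ → List Bit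
binarySeq p q = binSeq q p q

-- continued fraction digits of p/q (0 < p < q): p/q = [a₁,…,a_k]
-- = 1/(a₁ + 1/(a₂ + ⋯ + 1/a_k)), computed by the Euclidean algorithm
-- (the canonical expansion, a_k ≥ 2).  First argument is fuel.
cfD : ℕ → ℕ → ℕ → List ℕ
cfD zero    _       _ = []
cfD (suc f) zero    q = []
cfD (suc f) (suc p) q = (q / suc p) ∷ cfD f (q % suc p) (suc p)

cfDigits : ℕ → ℕ → List ℕ
cfDigits p q = cfD q p q

-- A word u in the letters of Φ acts on (1,1) as the product Φ_{u₁}⋯Φ_{u_k}, and the extended
-- binary sequence σ₁⋯σ_ℓ1 of r/n is the word sending (1,1) to (r,n).  The anti-automorphism
-- M ↦ K·adj(M)·K with K = (1 0; 1 −1) fixes Φ₀ and Φ₁, so it maps the product of a word to the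
-- product of the reversed word.  Splitting the extended sequence as A·B after the m-th letter,
-- the reversed sequence is rev(B)·rev(A): rev(A) sends (1,1) to (k₁, k₁+k₂), and the last
-- column of rev(B) is read off from (n₂,n₁) = B(1,1), which yields the conjugate partition.
-- Continued fraction digits are the run lengths of the extended binary sequence (a digit a
-- contributing the block 0 1^{a−1}), so reversing the sequence reverses the digits.
module Submission where

open import Defs
open import Data.Nat using (ℕ; zero; suc; _+_; _*_; _∸_; _≤_; _<_; z≤n; s≤s; >-nonZero)
open import Data.Nat.Properties
open import Data.Nat.DivMod using (_/_; _%_; m≡m%n+[m/n]*n; m%n<n; m≥n⇒m/n>0)
open import Data.Nat.Divisibility using (divides; ∣-refl; ∣-trans; n∣m*n; ∣m∣n⇒∣m+n; ∣m∸n∣n⇒∣m)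
open import Data.Nat.GCD using (gcd)
open import Data.Nat.Coprimality as Coprime using (Coprime; coprime-+; gcd≡1⇒coprime; coprime⇒gcd≡1; 1-coprimeTo)
open import Data.Nat.Tactic.RingSolver using (solve-∀)
open import Data.Product using (Σ; _×_; _,_; proj₁; proj₂; uncurry)
open import Data.Product.Properties using (×-≡,≡→≡)
open import Data.List using (List; []; _∷_; _++_; _∷ʳ_; [_]; length; take; drop; reverse; replicate; concat; map; concatMap)
open import Data.List.Properties
  using (++-assoc; ++-identityʳ; map-++; concat-++; unfold-reverse; reverse-++; length-reverse; length-drop; take++drop≡id; ∷-injectiveʳ; ∷ʳ-injectiveˡ)
open import Data.List.Relation.Unary.All using (All; []; _∷_)
open import Data.List.Relation.Unary.All.Properties using (∷ʳ⁺)
open import Data.Empty using (⊥-elim)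
open import Relation.Binary.Definitions using (tri<; tri≈; tri>)
open import Relation.Binary.PropositionalEquality using (_≡_; refl; sym; trans; cong; cong₂; subst; module ≡-Reasoning)

open Mat

-- Words in the letters of Φ acting on pairs

1*m+0*n≡m : ∀ m n → 1 * m + 0 * n ≡ m
1*m+0*n≡m = solve-∀

0*m+1*n≡n : ∀ m n → 0 * m + 1 * n ≡ n
0*m+1*n≡n = solve-∀

1*m+1*n≡m+n : ∀ m n → 1 * m + 1 * n ≡ m + n
1*m+1*n≡m+n = solve-∀

act-⊗ : ∀ M N x → act (M ⊗ N) x ≡ act M (act N x)
act-⊗ (mat a b c d) (mat a′ b′ c′ d′) (p , q) =
  ×-≡,≡→≡ (row-assoc a b a′ b′ c′ d′ p q , row-assoc c d a′ b′ c′ d′ p q)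
  where
  row-assoc : ∀ a b a′ b′ c′ d′ p q →
    (a * a′ + b * c′) * p + (a * b′ + b * d′) * q ≡ a * (a′ * p + b′ * q) + b * (c′ * p + d′ * q)
  row-assoc = solve-∀

act-id : ∀ x → act (mat 1 0 0 1) x ≡ x
act-id (p , q) = ×-≡,≡→≡ (1*m+0*n≡m p q , 0*m+1*n≡n p q)

act-01 : ∀ M → act M (0 , 1) ≡ (e12 M , e22 M)
act-01 (mat a b c d) rewrite *-zeroʳ a | *-identityʳ b | *-zeroʳ c | *-identityʳ d = refl

act-11 : ∀ M → act M (1 , 1) ≡ (e11 M + e12 M , e21 M + e22 M)
act-11 (mat a b c d) rewrite *-identityʳ a | *-identityʳ b | *-identityʳ c | *-identityʳ d = refl

stepΦ : Bit → ℕ × ℕ → ℕ × ℕ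
stepΦ b0 (p , q) = (q , p + q)
stepΦ b1 (p , q) = (p , p + q)

runΦ : List Bit → ℕ × ℕ → ℕ × ℕ
runΦ []      x = x
runΦ (b ∷ u) x = stepΦ b (runΦ u x)

act-Φ : ∀ b x → act (Φ b) x ≡ stepΦ b x
act-Φ b0 (p , q) = ×-≡,≡→≡ (0*m+1*n≡n p q , 1*m+1*n≡m+n p q)
act-Φ b1 (p , q) = ×-≡,≡→≡ (1*m+0*n≡m p q , 1*m+1*n≡m+n p q)

act-prodΦ : ∀ u x → act (prodΦ u) x ≡ runΦ u x
act-prodΦ []      x = act-id x
act-prodΦ (b ∷ u) x = begin
  act (Φ b ⊗ prodΦ u) x       ≡⟨ act-⊗ (Φ b) (prodΦ u) x ⟩
  act (Φ b) (act (prodΦ u) x) ≡⟨ act-Φ b _ ⟩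
  stepΦ b (act (prodΦ u) x)   ≡⟨ cong (stepΦ b) (act-prodΦ u x) ⟩
  stepΦ b (runΦ u x)          ∎
  where open ≡-Reasoning

runΦ-01 : ∀ u → runΦ u (0 , 1) ≡ (e12 (prodΦ u) , e22 (prodΦ u))
runΦ-01 u = trans (sym (act-prodΦ u (0 , 1))) (act-01 (prodΦ u))

runΦ-11 : ∀ u → runΦ u (1 , 1) ≡ (e11 (prodΦ u) + e12 (prodΦ u) , e21 (prodΦ u) + e22 (prodΦ u))
runΦ-11 u = trans (sym (act-prodΦ u (1 , 1))) (act-11 (prodΦ u))

runΦ-++ : ∀ u v x → runΦ (u ++ v) x ≡ runΦ u (runΦ v x)
runΦ-++ []      v x = refl
runΦ-++ (b ∷ u) v x = cong (stepΦ b) (runΦ-++ u v x)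

runΦ-∷ʳ-b1 : ∀ u → runΦ (u ∷ʳ b1) (1 , 1) ≡ runΦ u (1 , 2)
runΦ-∷ʳ-b1 u = runΦ-++ u [ b1 ] (1 , 1)

stepΦ-injective : ∀ b {x y} → stepΦ b x ≡ stepΦ b y → x ≡ y
stepΦ-injective b0 {p , q} {p′ , q′} eq with cong proj₁ eq
... | refl = ×-≡,≡→≡ (+-cancelʳ-≡ q p p′ (cong proj₂ eq) , refl)
stepΦ-injective b1 {p , q} {p′ , q′} eq with cong proj₁ eq
... | refl = ×-≡,≡→≡ (refl , +-cancelˡ-≡ p q q′ (cong proj₂ eq))

runΦ-injective : ∀ u {x y} → runΦ u x ≡ runΦ u y → x ≡ y
runΦ-injective []      eq = eq
runΦ-injective (b ∷ u) eq = runΦ-injective u (stepΦ-injective b eq)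

runΦ-replicate-b1 : ∀ j x y → runΦ (replicate j b1) (x , y) ≡ (x , j * x + y)
runΦ-replicate-b1 zero    x y = refl
runΦ-replicate-b1 (suc j) x y =
  trans (cong (stepΦ b1) (runΦ-replicate-b1 j x y)) (cong (x ,_) (sym (+-assoc x (j * x) y)))

-- With prodΦ u = (a b; c d), so that runΦ u (0 , 1) = (b , d) and runΦ u (1 , 1) = (a + b , c + d),
-- this says prodΦ (reverse u) = K · adj (prodΦ u) · K for K = (1 0; 1 −1): that map reverses
-- products and fixes each Φ x.  Evaluating at (p , p + q) keeps the formula free of subtraction.
runΦ-reverse : ∀ u p q → runΦ (reverse u) (p , p + q) ≡
  (proj₂ (runΦ u (0 , 1)) * p + proj₁ (runΦ u (0 , 1)) * q ,
   proj₂ (runΦ u (1 , 1)) * p + proj₁ (runΦ u (1 , 1)) * q)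
runΦ-reverse []      p q = sym (×-≡,≡→≡ (1*m+0*n≡m p q , 1*m+1*n≡m+n p q))
runΦ-reverse (b ∷ u) p q =
  trans (cong (λ v → runΦ v (p , p + q)) (unfold-reverse b u))
        (trans (runΦ-++ (reverse u) [ b ] (p , p + q)) (reverse-step b))
  where
  open ≡-Reasoning
  b′ d′ e′ f′ : ℕ
  b′ = proj₁ (runΦ u (0 , 1))
  d′ = proj₂ (runΦ u (0 , 1))
  e′ = proj₁ (runΦ u (1 , 1))
  f′ = proj₂ (runΦ u (1 , 1))
  reverse-step : ∀ x → runΦ (reverse u) (stepΦ x (p , p + q)) ≡
    (proj₂ (stepΦ x (b′ , d′)) * p + proj₁ (stepΦ x (b′ , d′)) * q ,
     proj₂ (stepΦ x (e′ , f′)) * p + proj₁ (stepΦ x (e′ , f′)) * q)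
  reverse-step b0 = begin
    runΦ (reverse u) (p + q , p + (p + q)) ≡⟨ cong (λ z → runΦ (reverse u) (p + q , z)) (+-comm p (p + q)) ⟩
    runΦ (reverse u) (p + q , (p + q) + p) ≡⟨ runΦ-reverse u (p + q) p ⟩
    (d′ * (p + q) + b′ * p , f′ * (p + q) + e′ * p) ≡⟨ ×-≡,≡→≡ (regroup b′ d′ p q , regroup e′ f′ p q) ⟩
    ((b′ + d′) * p + d′ * q , (e′ + f′) * p + f′ * q) ∎
    where
    regroup : ∀ b d p q → d * (p + q) + b * p ≡ (b + d) * p + d * q
    regroup = solve-∀
  reverse-step b1 = trans (runΦ-reverse u p (p + q)) (×-≡,≡→≡ (regroup b′ d′ p q , regroup e′ f′ p q))
    where
    regroup : ∀ b d p q → d * p + b * (p + q) ≡ (b + d) * p + b * q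
    regroup = solve-∀

runΦ-reverse-01 : ∀ u → runΦ (reverse u) (0 , 1) ≡ (proj₁ (runΦ u (0 , 1)) , proj₁ (runΦ u (1 , 1)))
runΦ-reverse-01 u rewrite runΦ-reverse u 0 1
  | *-zeroʳ (proj₂ (runΦ u (0 , 1))) | *-identityʳ (proj₁ (runΦ u (0 , 1)))
  | *-zeroʳ (proj₂ (runΦ u (1 , 1))) | *-identityʳ (proj₁ (runΦ u (1 , 1))) = refl

runΦ-reverse-11 : ∀ u → runΦ (reverse u) (1 , 1) ≡ (proj₂ (runΦ u (0 , 1)) , proj₂ (runΦ u (1 , 1)))
runΦ-reverse-11 u rewrite runΦ-reverse u 1 0
  | *-identityʳ (proj₂ (runΦ u (0 , 1))) | *-zeroʳ (proj₁ (runΦ u (0 , 1)))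
  | *-identityʳ (proj₂ (runΦ u (1 , 1))) | *-zeroʳ (proj₁ (runΦ u (1 , 1)))
  | +-identityʳ (proj₂ (runΦ u (0 , 1))) | +-identityʳ (proj₂ (runΦ u (1 , 1))) = refl

-- Walks from 1/2 and the binary sequence

record InFareyTree (p q : ℕ) : Set where
  constructor fraction
  field
    0<p : 0 < p
    p<q : p < q
    coprime : Coprime p q

coprime-∸ : ∀ {p q} → p ≤ q → Coprime p q → Coprime (q ∸ p) p
coprime-∸ p≤q cop (d∣q∸p , d∣p) = cop (d∣p , ∣m∸n∣n⇒∣m _ p≤q d∣q∸p d∣p)

coprime-remainder : ∀ {P ρ a} → Coprime P (ρ + a * P) → Coprime ρ P
coprime-remainder {a = a} cop (d∣ρ , d∣P) = cop (d∣P , ∣m∣n⇒∣m+n d∣ρ (∣-trans d∣P (n∣m*n a)))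

2*m≡m+m : ∀ m → 2 * m ≡ m + m
2*m≡m+m m = cong (m +_) (+-identityʳ m)

inFareyTree-b0 : ∀ {p q} → InFareyTree p q → InFareyTree q (p + q)
inFareyTree-b0 {p} {q} (fraction 0<p p<q cop) =
  fraction (<-trans 0<p p<q) (subst (q <_) (+-comm q p) (m<m+n q 0<p))
           (subst (Coprime q) (+-comm q p) (Coprime.sym (coprime-+ cop)))

inFareyTree-b1 : ∀ {p q} → InFareyTree p q → InFareyTree p (p + q)
inFareyTree-b1 {p} (fraction 0<p p<q cop) =
  fraction 0<p (m<m+n p (<-trans 0<p p<q)) (Coprime.sym (coprime-+ (Coprime.sym cop)))

runΦ-inFareyTree : ∀ u → uncurry InFareyTree (runΦ u (1 , 2))
runΦ-inFareyTree []       = fraction (s≤s z≤n) (s≤s (s≤s z≤n)) (1-coprimeTo 2)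
runΦ-inFareyTree (b0 ∷ u) = inFareyTree-b0 (runΦ-inFareyTree u)
runΦ-inFareyTree (b1 ∷ u) = inFareyTree-b1 (runΦ-inFareyTree u)

runΦ-length : ∀ u → 2 + length u ≤ proj₂ (runΦ u (1 , 2))
runΦ-length []      = ≤-refl
runΦ-length (b0 ∷ u) = +-mono-≤ (InFareyTree.0<p (runΦ-inFareyTree u)) (runΦ-length u)
runΦ-length (b1 ∷ u) = +-mono-≤ (InFareyTree.0<p (runΦ-inFareyTree u)) (runΦ-length u)

binSeq-< : ∀ f p q → 2 * p < q → binSeq (suc f) p q ≡ b1 ∷ binSeq f p (q ∸ p)
binSeq-< f p q lt with <-cmp (2 * p) q
... | tri< _ _ _    = refl
... | tri≈ ¬lt _ _  = ⊥-elim (¬lt lt)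
... | tri> ¬lt _ _  = ⊥-elim (¬lt lt)

binSeq-> : ∀ f p q → q < 2 * p → binSeq (suc f) p q ≡ b0 ∷ binSeq f (q ∸ p) p
binSeq-> f p q gt with <-cmp (2 * p) q
... | tri< _ _ ¬gt  = ⊥-elim (¬gt gt)
... | tri≈ _ _ ¬gt  = ⊥-elim (¬gt gt)
... | tri> _ _ _    = refl

binSeq-runΦ : ∀ u f → length u < f → uncurry (binSeq f) (runΦ u (1 , 2)) ≡ u
binSeq-runΦ []       (suc f) _ = refl
binSeq-runΦ (b0 ∷ u) (suc f) (s≤s len<f) = begin
  binSeq (suc f) q (p + q)       ≡⟨ binSeq-> f q (p + q) (subst (p + q <_) (sym (2*m≡m+m q)) (+-monoˡ-< q p<q)) ⟩
  b0 ∷ binSeq f (p + q ∸ q) q    ≡⟨ cong (λ z → b0 ∷ binSeq f z q) (m+n∸n≡m p q) ⟩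
  b0 ∷ binSeq f p q              ≡⟨ cong (b0 ∷_) (binSeq-runΦ u f len<f) ⟩
  b0 ∷ u                         ∎
  where
  open ≡-Reasoning
  p q : ℕ
  p = proj₁ (runΦ u (1 , 2))
  q = proj₂ (runΦ u (1 , 2))
  p<q : p < q
  p<q = InFareyTree.p<q (runΦ-inFareyTree u)
binSeq-runΦ (b1 ∷ u) (suc f) (s≤s len<f) = begin
  binSeq (suc f) p (p + q)       ≡⟨ binSeq-< f p (p + q) (subst (_< p + q) (sym (2*m≡m+m p)) (+-monoʳ-< p p<q)) ⟩
  b1 ∷ binSeq f p (p + q ∸ p)    ≡⟨ cong (λ z → b1 ∷ binSeq f p z) (m+n∸m≡n p q) ⟩
  b1 ∷ binSeq f p q              ≡⟨ cong (b1 ∷_) (binSeq-runΦ u f len<f) ⟩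
  b1 ∷ u                         ∎
  where
  open ≡-Reasoning
  p q : ℕ
  p = proj₁ (runΦ u (1 , 2))
  q = proj₂ (runΦ u (1 , 2))
  p<q : p < q
  p<q = InFareyTree.p<q (runΦ-inFareyTree u)

binarySeq-runΦ : ∀ u {p q} → runΦ u (1 , 2) ≡ (p , q) → binarySeq p q ≡ u
binarySeq-runΦ u {p} {q} eq = subst (λ x → binSeq q (proj₁ x) (proj₂ x) ≡ u) eq
  (binSeq-runΦ u q (subst (λ x → length u < proj₂ x) eq (≤-trans (n≤1+n _) (runΦ-length u))))

runΦ-binSeq : ∀ f p q → InFareyTree p q → q ≤ f → runΦ (binSeq f p q) (1 , 2) ≡ (p , q)
runΦ-binSeq zero    p q (fraction _ p<q _) z≤n = ⊥-elim (n≮0 p<q)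
runΦ-binSeq (suc f) p q (fraction 0<p p<q cop) q≤1+f with <-cmp (2 * p) q
... | tri< 2p<q _ _ = begin
  stepΦ b1 (runΦ (binSeq f p (q ∸ p)) (1 , 2)) ≡⟨ cong (stepΦ b1) (runΦ-binSeq f p (q ∸ p) smaller q∸p≤f) ⟩
  (p , p + (q ∸ p))                            ≡⟨ cong (p ,_) (m+[n∸m]≡n (<⇒≤ p<q)) ⟩
  (p , q)                                      ∎
  where
  open ≡-Reasoning
  smaller : InFareyTree p (q ∸ p)
  smaller = fraction 0<p (m+n≤o⇒m≤o∸n (suc p) (subst (λ z → suc z ≤ q) (2*m≡m+m p) 2p<q))
                     (Coprime.sym (coprime-∸ (<⇒≤ p<q) cop))
  q∸p≤f : q ∸ p ≤ f
  q∸p≤f = m≤n+o⇒m∸n≤o q p (≤-trans q≤1+f (+-monoˡ-≤ f 0<p))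
... | tri> _ _ q<2p = begin
  stepΦ b0 (runΦ (binSeq f (q ∸ p) p) (1 , 2)) ≡⟨ cong (stepΦ b0) (runΦ-binSeq f (q ∸ p) p smaller p≤f) ⟩
  (p , q ∸ p + p)                              ≡⟨ cong (p ,_) (m∸n+n≡m (<⇒≤ p<q)) ⟩
  (p , q)                                      ∎
  where
  open ≡-Reasoning
  smaller : InFareyTree (q ∸ p) p
  smaller = fraction (m<n⇒0<n∸m p<q) (m<n+o⇒m∸n<o q p {{>-nonZero 0<p}} (subst (q <_) (2*m≡m+m p) q<2p))
                     (coprime-∸ (<⇒≤ p<q) cop)
  p≤f : p ≤ f
  p≤f = ≤-pred (≤-trans p<q q≤1+f)
... | tri≈ _ 2p≡q _ with cop (∣-refl , divides 2 (sym 2p≡q))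
...   | refl = cong (1 ,_) 2p≡q

runΦ-binarySeq : ∀ {p q} → InFareyTree p q → runΦ (binarySeq p q) (1 , 2) ≡ (p , q)
runΦ-binarySeq {p} {q} p/q = runΦ-binSeq q p q p/q ≤-refl

binarySeq-head : ∀ {p q} → 2 * p < q → binarySeq p q ≡ b1 ∷ drop 1 (binarySeq p q)
binarySeq-head {p} {suc f} 2p<q = trans unfold (cong (λ w → b1 ∷ drop 1 w) (sym unfold))
  where
  unfold : binarySeq p (suc f) ≡ b1 ∷ binSeq f p (suc f ∸ p)
  unfold = binSeq-< f p (suc f) 2p<q

-- Reversal and the conjugate partition

reverse-∷ʳ : ∀ {A : Set} (xs : List A) x → reverse (xs ∷ʳ x) ≡ x ∷ reverse xs
reverse-∷ʳ xs x = reverse-++ xs [ x ]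

take-length-++ : ∀ {A : Set} (xs ys : List A) → take (length xs) (xs ++ ys) ≡ xs
take-length-++ []       ys = refl
take-length-++ (x ∷ xs) ys = cong (x ∷_) (take-length-++ xs ys)

take-reverse : ∀ {A : Set} m (xs : List A) → take (length xs ∸ m) (reverse xs) ≡ reverse (drop m xs)
take-reverse m xs = begin
  take (length xs ∸ m) (reverse xs)
    ≡⟨ cong (λ ys → take (length xs ∸ m) (reverse ys)) (sym (take++drop≡id m xs)) ⟩
  take (length xs ∸ m) (reverse (take m xs ++ drop m xs))
    ≡⟨ cong (take (length xs ∸ m)) (reverse-++ (take m xs) (drop m xs)) ⟩
  take (length xs ∸ m) (reverse (drop m xs) ++ reverse (take m xs))
    ≡⟨ cong (λ k → take k (reverse (drop m xs) ++ reverse (take m xs))) length-suffix ⟩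
  take (length (reverse (drop m xs))) (reverse (drop m xs) ++ reverse (take m xs))
    ≡⟨ take-length-++ (reverse (drop m xs)) (reverse (take m xs)) ⟩
  reverse (drop m xs) ∎
  where
  open ≡-Reasoning
  length-suffix : length xs ∸ m ≡ length (reverse (drop m xs))
  length-suffix = sym (trans (length-reverse (drop m xs)) (length-drop m xs))

take-reversed-tail : ∀ {A : Set} (xs : List A) x m → 1 ≤ m → m ≤ length xs →
  take (length xs + 1 ∸ m) (x ∷ reverse (drop 1 xs)) ≡ reverse (drop m xs ∷ʳ x)
take-reversed-tail (y ∷ xs) x (suc m) _ (s≤s m≤len) = begin
  take (length xs + 1 ∸ m) (x ∷ reverse xs) ≡⟨ cong (λ k → take k (x ∷ reverse xs)) index ⟩
  x ∷ take (length xs ∸ m) (reverse xs)     ≡⟨ cong (x ∷_) (take-reverse m xs) ⟩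
  x ∷ reverse (drop m xs)                   ≡⟨ sym (reverse-∷ʳ (drop m xs) x) ⟩
  reverse (drop m xs ∷ʳ x)                  ∎
  where
  open ≡-Reasoning
  index : length xs + 1 ∸ m ≡ suc (length xs ∸ m)
  index = trans (+-∸-comm 1 m≤len) (+-comm (length xs ∸ m) 1)

reverse-split : ∀ A B {t s k₂ k₁ n₂ n₁ x̃} → prodΦ A ≡ mat t s k₂ k₁ → runΦ B (1 , 1) ≡ (n₂ , n₁) →
  runΦ (reverse (A ++ B)) (1 , 1) ≡ x̃ →
  Σ ℕ λ t̃ → Σ ℕ λ s̃ → Σ ℕ λ k̃₂ →
    k̃₂ + n₂ ≡ n₁ × prodΦ (reverse B) ≡ mat t̃ s̃ k̃₂ n₂ × act (mat t̃ s̃ k̃₂ n₂) (k₁ , k₁ + k₂) ≡ x̃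
reverse-split A B {t} {s} {k₂} {k₁} {n₂} {n₁} prodA runB refl =
  e11 Ñ , e12 Ñ , e21 Ñ , subst (λ z → e21 Ñ + z ≡ n₁) e22≡n₂ e21+e22≡n₁ , Ñ≡ , runΦ-reverse-AB
  where
  open ≡-Reasoning
  Ñ : Mat
  Ñ = prodΦ (reverse B)
  e22≡n₂ : e22 Ñ ≡ n₂
  e22≡n₂ = trans (cong proj₂ (trans (sym (runΦ-01 (reverse B))) (runΦ-reverse-01 B))) (cong proj₁ runB)
  e21+e22≡n₁ : e21 Ñ + e22 Ñ ≡ n₁
  e21+e22≡n₁ = trans (cong proj₂ (trans (sym (runΦ-11 (reverse B))) (runΦ-reverse-11 B))) (cong proj₂ runB)
  Ñ≡ : Ñ ≡ mat (e11 Ñ) (e12 Ñ) (e21 Ñ) n₂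
  Ñ≡ = cong (mat (e11 Ñ) (e12 Ñ) (e21 Ñ)) e22≡n₂
  runΦ-reverse-A : runΦ (reverse A) (1 , 1) ≡ (k₁ , k₁ + k₂)
  runΦ-reverse-A rewrite runΦ-reverse-11 A | runΦ-01 A | runΦ-11 A | prodA = cong (k₁ ,_) (+-comm k₂ k₁)
  runΦ-reverse-AB : act (mat (e11 Ñ) (e12 Ñ) (e21 Ñ) n₂) (k₁ , k₁ + k₂) ≡ runΦ (reverse (A ++ B)) (1 , 1)
  runΦ-reverse-AB = begin
    act (mat (e11 Ñ) (e12 Ñ) (e21 Ñ) n₂) (k₁ , k₁ + k₂) ≡⟨ cong (λ M → act M (k₁ , k₁ + k₂)) (sym Ñ≡) ⟩
    act Ñ (k₁ , k₁ + k₂)                               ≡⟨ act-prodΦ (reverse B) (k₁ , k₁ + k₂) ⟩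
    runΦ (reverse B) (k₁ , k₁ + k₂)                    ≡⟨ cong (runΦ (reverse B)) (sym runΦ-reverse-A) ⟩
    runΦ (reverse B) (runΦ (reverse A) (1 , 1))        ≡⟨ sym (runΦ-++ (reverse B) (reverse A) (1 , 1)) ⟩
    runΦ (reverse B ++ reverse A) (1 , 1)              ≡⟨ cong (λ v → runΦ v (1 , 1)) (sym (reverse-++ A B)) ⟩
    runΦ (reverse (A ++ B)) (1 , 1)                    ∎

conjugate-generation : ∀ w m {t s k₂ k₁ n₂ n₁ x x̃} → 1 ≤ m → m ≤ length w →
  runΦ w (1 , 2) ≡ x → runΦ (reverse (w ∷ʳ b1)) (1 , 1) ≡ x̃ →
  prodΦ (take m w) ≡ mat t s k₂ k₁ → act (mat t s k₂ k₁) (n₂ , n₁) ≡ x →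
  Σ ℕ λ t̃ → Σ ℕ λ s̃ → Σ ℕ λ k̃₂ →
    k̃₂ + n₂ ≡ n₁
    × prodΦ (take (length w + 1 ∸ m) (b1 ∷ reverse (drop 1 w))) ≡ mat t̃ s̃ k̃₂ n₂
    × act (mat t̃ s̃ k̃₂ n₂) (k₁ , k₁ + k₂) ≡ x̃
conjugate-generation w m {t} {s} {k₂} {k₁} {n₂} {n₁} 1≤m m≤ℓ refl reversed-run prodA actA
  rewrite take-reversed-tail w b1 m 1≤m m≤ℓ =
  reverse-split A B prodA runΦ-B (trans (cong (λ v → runΦ (reverse v) (1 , 1)) AB≡w1) reversed-run)
  where
  open ≡-Reasoning
  A B : List Bit
  A = take m w
  B = drop m w ∷ʳ b1
  AB≡w1 : A ++ B ≡ w ∷ʳ b1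
  AB≡w1 = trans (sym (++-assoc A (drop m w) [ b1 ])) (cong (_∷ʳ b1) (take++drop≡id m w))
  runΦ-B : runΦ B (1 , 1) ≡ (n₂ , n₁)
  runΦ-B = runΦ-injective A (begin
    runΦ A (runΦ B (1 , 1))       ≡⟨ sym (runΦ-++ A B (1 , 1)) ⟩
    runΦ (A ++ B) (1 , 1)         ≡⟨ cong (λ v → runΦ v (1 , 1)) AB≡w1 ⟩
    runΦ (w ∷ʳ b1) (1 , 1)        ≡⟨ runΦ-∷ʳ-b1 w ⟩
    runΦ w (1 , 2)                ≡⟨ sym actA ⟩
    act (mat t s k₂ k₁) (n₂ , n₁) ≡⟨ cong (λ M → act M (n₂ , n₁)) (sym prodA) ⟩
    act (prodΦ A) (n₂ , n₁)       ≡⟨ act-prodΦ A (n₂ , n₁) ⟩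
    runΦ A (n₂ , n₁)              ∎)

reverse-extended : ∀ {p q} → 2 * p < q →
  reverse (binarySeq p q ∷ʳ b1) ≡ (b1 ∷ reverse (drop 1 (binarySeq p q))) ∷ʳ b1
reverse-extended {p} {q} 2p<q = begin
  reverse (binarySeq p q ∷ʳ b1)              ≡⟨ reverse-∷ʳ (binarySeq p q) b1 ⟩
  b1 ∷ reverse (binarySeq p q)               ≡⟨ cong (λ w → b1 ∷ reverse w) (binarySeq-head 2p<q) ⟩
  b1 ∷ reverse (b1 ∷ drop 1 (binarySeq p q)) ≡⟨ cong (b1 ∷_) (unfold-reverse b1 (drop 1 (binarySeq p q))) ⟩
  b1 ∷ reverse (drop 1 (binarySeq p q)) ∷ʳ b1 ∎
  where open ≡-Reasoning

reversed-denominator : ∀ {r n} → InFareyTree r n → 2 * r < n →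
  proj₂ (runΦ (b1 ∷ reverse (drop 1 (binarySeq r n))) (1 , 2)) ≡ n
reversed-denominator {r} {n} r/n 2r<n = begin
  proj₂ (runΦ w̃ (1 , 2))                   ≡⟨ cong proj₂ (sym (runΦ-∷ʳ-b1 w̃)) ⟩
  proj₂ (runΦ (w̃ ∷ʳ b1) (1 , 1))           ≡⟨ cong (λ u → proj₂ (runΦ u (1 , 1))) (sym (reverse-extended 2r<n)) ⟩
  proj₂ (runΦ (reverse (w ∷ʳ b1)) (1 , 1)) ≡⟨ cong proj₂ (runΦ-reverse-11 (w ∷ʳ b1)) ⟩
  proj₂ (runΦ (w ∷ʳ b1) (1 , 1))           ≡⟨ cong proj₂ (runΦ-∷ʳ-b1 w) ⟩
  proj₂ (runΦ w (1 , 2))                   ≡⟨ cong proj₂ (runΦ-binarySeq r/n) ⟩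
  n                                        ∎
  where
  open ≡-Reasoning
  w w̃ : List Bit
  w = binarySeq r n
  w̃ = b1 ∷ reverse (drop 1 w)

-- Continued fraction digits as run lengths

-- The extended binary sequence of [a₁, …, a_k] is 1^{a₁−1} 0 1^{a₂−1} 0 ⋯ 0 1^{a_k−1};
-- preceded by 0 it is the concatenation of the blocks of the digits.
block : ℕ → List Bit
block a = b0 ∷ replicate (a ∸ 1) b1

replicate-∷ʳ : ∀ {A : Set} n (x : A) → replicate (suc n) x ≡ replicate n x ∷ʳ x
replicate-∷ʳ zero    x = refl
replicate-∷ʳ (suc n) x = cong (x ∷_) (replicate-∷ʳ n x)

reverse-replicate : ∀ {A : Set} n (x : A) → reverse (replicate n x) ≡ replicate n x
reverse-replicate zero    x = refl
reverse-replicate (suc n) x = begin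
  reverse (x ∷ replicate n x)   ≡⟨ unfold-reverse x (replicate n x) ⟩
  reverse (replicate n x) ∷ʳ x  ≡⟨ cong (_∷ʳ x) (reverse-replicate n x) ⟩
  replicate n x ∷ʳ x            ≡⟨ sym (replicate-∷ʳ n x) ⟩
  x ∷ replicate n x             ∎
  where open ≡-Reasoning

concatMap-∷ʳ : ∀ {A B : Set} (f : A → List B) xs x → concatMap f (xs ∷ʳ x) ≡ concatMap f xs ++ f x
concatMap-∷ʳ f xs x = begin
  concat (map f (xs ∷ʳ x))              ≡⟨ cong concat (map-++ f xs [ x ]) ⟩
  concat (map f xs ++ [ f x ])          ≡⟨ sym (concat-++ (map f xs) [ f x ]) ⟩
  concat (map f xs) ++ f x ++ []        ≡⟨ cong (concat (map f xs) ++_) (++-identityʳ (f x)) ⟩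
  concat (map f xs) ++ f x              ∎
  where open ≡-Reasoning

reverse-blocks : ∀ ds → reverse (concatMap block ds ∷ʳ b0) ≡ concatMap block (reverse ds) ∷ʳ b0
reverse-blocks []       = refl
reverse-blocks (a ∷ ds) = begin
  reverse (b0 ∷ (R ++ C) ∷ʳ b0)             ≡⟨ cong (λ u → reverse (b0 ∷ u)) (++-assoc R C [ b0 ]) ⟩
  reverse (b0 ∷ R ++ C ∷ʳ b0)               ≡⟨ unfold-reverse b0 (R ++ C ∷ʳ b0) ⟩
  reverse (R ++ C ∷ʳ b0) ∷ʳ b0              ≡⟨ cong (_∷ʳ b0) (reverse-++ R (C ∷ʳ b0)) ⟩
  (reverse (C ∷ʳ b0) ++ reverse R) ∷ʳ b0    ≡⟨ cong₂ (λ u v → (u ++ v) ∷ʳ b0) (reverse-blocks ds) (reverse-replicate (a ∸ 1) b1) ⟩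
  (C̃ ∷ʳ b0 ++ R) ∷ʳ b0                     ≡⟨ cong (_∷ʳ b0) (++-assoc C̃ [ b0 ] R) ⟩
  (C̃ ++ block a) ∷ʳ b0                      ≡⟨ cong (_∷ʳ b0) (sym (concatMap-∷ʳ block (reverse ds) a)) ⟩
  concatMap block (reverse ds ∷ʳ a) ∷ʳ b0   ≡⟨ cong (λ u → concatMap block u ∷ʳ b0) (sym (unfold-reverse a ds)) ⟩
  concatMap block (reverse (a ∷ ds)) ∷ʳ b0  ∎
  where
  open ≡-Reasoning
  R C C̃ : List Bit
  R = replicate (a ∸ 1) b1
  C = concatMap block ds
  C̃ = concatMap block (reverse ds)

-- Reads back the digits from their blocks; k is one more than the length of the current run
-- of b1, so the block 0 1^{a−1} is read as a.
runLengths : ℕ → List Bit → List ℕ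
runLengths k []       = k ∷ []
runLengths k (b0 ∷ u) = k ∷ runLengths 1 u
runLengths k (b1 ∷ u) = runLengths (suc k) u

runLengths-replicate : ∀ j k u → runLengths k (replicate j b1 ++ u) ≡ runLengths (j + k) u
runLengths-replicate zero    k u = refl
runLengths-replicate (suc j) k u = trans (runLengths-replicate j (suc k) u) (cong (λ i → runLengths i u) (+-suc j k))

runLengths-blocks : ∀ k ds → All (1 ≤_) ds → runLengths k (concatMap block ds) ≡ k ∷ ds
runLengths-blocks k []       []           = refl
runLengths-blocks k (a ∷ ds) (1≤a ∷ 1≤ds) = cong (k ∷_) (begin
  runLengths 1 (replicate (a ∸ 1) b1 ++ concatMap block ds) ≡⟨ runLengths-replicate (a ∸ 1) 1 (concatMap block ds) ⟩
  runLengths (a ∸ 1 + 1) (concatMap block ds)               ≡⟨ cong (λ i → runLengths i (concatMap block ds)) (m∸n+n≡m 1≤a) ⟩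
  runLengths a (concatMap block ds)                         ≡⟨ runLengths-blocks a ds 1≤ds ⟩
  a ∷ ds                                                    ∎)
  where open ≡-Reasoning

blocks-injective : ∀ {ds es} → All (1 ≤_) ds → All (1 ≤_) es → concatMap block ds ≡ concatMap block es → ds ≡ es
blocks-injective {ds} {es} 1≤ds 1≤es eq = ∷-injectiveʳ (begin
  0 ∷ ds                             ≡⟨ sym (runLengths-blocks 0 ds 1≤ds) ⟩
  runLengths 0 (concatMap block ds)  ≡⟨ cong (runLengths 0) eq ⟩
  runLengths 0 (concatMap block es)  ≡⟨ runLengths-blocks 0 es 1≤es ⟩
  0 ∷ es                             ∎)
  where open ≡-Reasoning

All-reverse : ∀ {A : Set} {P : A → Set} {xs} → All P xs → All P (reverse xs)
All-reverse {P = P} []                 = []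
All-reverse {P = P} {x ∷ xs} (px ∷ pxs) = subst (All P) (sym (unfold-reverse x xs)) (∷ʳ⁺ (All-reverse pxs) px)

cfD-positive : ∀ f p q → p ≤ q → All (1 ≤_) (cfD f p q)
cfD-positive zero    _       _ _   = []
cfD-positive (suc f) zero    _ _   = []
cfD-positive (suc f) (suc p) q p<q = m≥n⇒m/n>0 p<q ∷ cfD-positive f (q % suc p) (suc p) (<⇒≤ (m%n<n q (suc p)))

cfD-zero : ∀ f q → cfD f 0 q ≡ []
cfD-zero zero    q = refl
cfD-zero (suc f) q = refl

blocks-prepend : ∀ {a ρ P} ds v → 1 ≤ a → concatMap block ds ≡ b0 ∷ v ∷ʳ b1 → runΦ v (1 , 2) ≡ (ρ , P) →
  concatMap block (a ∷ ds) ≡ b0 ∷ (replicate (a ∸ 1) b1 ++ b0 ∷ v) ∷ʳ b1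
  × runΦ (replicate (a ∸ 1) b1 ++ b0 ∷ v) (1 , 2) ≡ (P , ρ + a * P)
blocks-prepend {suc a} {ρ} {P} ds v _ blocks≡ runΦ-v =
  trans (cong (b0 ∷_) (cong (replicate a b1 ++_) blocks≡)) (cong (b0 ∷_) (sym (++-assoc (replicate a b1) (b0 ∷ v) [ b1 ]))) ,
  (begin
    runΦ (replicate a b1 ++ b0 ∷ v) (1 , 2)          ≡⟨ runΦ-++ (replicate a b1) (b0 ∷ v) (1 , 2) ⟩
    runΦ (replicate a b1) (stepΦ b0 (runΦ v (1 , 2))) ≡⟨ cong (λ x → runΦ (replicate a b1) (stepΦ b0 x)) runΦ-v ⟩
    runΦ (replicate a b1) (P , ρ + P)                ≡⟨ runΦ-replicate-b1 a P (ρ + P) ⟩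
    (P , a * P + (ρ + P))                            ≡⟨ cong (P ,_) (regroup a P ρ) ⟩
    (P , ρ + suc a * P)                              ∎)
  where
  open ≡-Reasoning
  regroup : ∀ a P ρ → a * P + (ρ + P) ≡ ρ + suc a * P
  regroup = solve-∀

blocks-single : ∀ f a → 1 < a → Σ (List Bit) λ v → concatMap block (a ∷ cfD f 0 1) ≡ b0 ∷ v ∷ʳ b1 × runΦ v (1 , 2) ≡ (1 , a)
blocks-single f (suc zero) (s≤s ())
blocks-single f (suc (suc k)) _ rewrite cfD-zero f 1 =
  replicate k b1 ,
  cong (b0 ∷_) (trans (++-identityʳ (replicate (suc k) b1)) (replicate-∷ʳ k b1)) ,
  trans (runΦ-replicate-b1 k 1 2) (cong (1 ,_) (trans (cong (_+ 2) (*-identityʳ k)) (+-comm k 2)))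

-- Each step of the Euclidean algorithm q = ρ + a·p prepends the block 0 1^{a−1} and lifts a
-- walk to ρ/p into a walk to p/q.
blocks-cfD : ∀ f p q → InFareyTree p q → q ≤ f →
  Σ (List Bit) λ v → concatMap block (cfD f p q) ≡ b0 ∷ v ∷ʳ b1 × runΦ v (1 , 2) ≡ (p , q)
blocks-cfD zero    p       q (fraction _ p<q _)  z≤n   = ⊥-elim (n≮0 p<q)
blocks-cfD (suc f) (suc p) q (fraction _ p<q cop) q≤1+f
  with q / suc p | q % suc p | m≡m%n+[m/n]*n q (suc p) | m%n<n q (suc p) | m≥n⇒m/n>0 {q} {suc p} (<⇒≤ p<q)
... | a | suc ρ | q≡ | ρ<P | 1≤a =
  let v , blocks≡ , runΦ-v = blocks-cfD f (suc ρ) (suc p) ρ/p p<f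
      blocks≡′ , runΦ-v′ = blocks-prepend (cfD f (suc ρ) (suc p)) v 1≤a blocks≡ runΦ-v
  in replicate (a ∸ 1) b1 ++ b0 ∷ v , blocks≡′ , trans runΦ-v′ (cong (suc p ,_) (sym q≡))
  where
  ρ/p : InFareyTree (suc ρ) (suc p)
  ρ/p = fraction (s≤s z≤n) ρ<P (coprime-remainder {a = a} (subst (Coprime (suc p)) q≡ cop))
  p<f : suc p ≤ f
  p<f = ≤-pred (≤-trans p<q q≤1+f)
... | a | zero | q≡ | _ | _ with cop (∣-refl , divides a q≡)
...   | refl rewrite trans q≡ (*-identityʳ a) = blocks-single f a p<q

blocks-cfDigits : ∀ {p q} → InFareyTree p q → concatMap block (cfDigits p q) ≡ b0 ∷ binarySeq p q ∷ʳ b1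
blocks-cfDigits {p} {q} p/q with blocks-cfD q p q p/q ≤-refl
... | v , blocks≡ , runΦ-v = trans blocks≡ (cong (λ u → b0 ∷ u ∷ʳ b1) (sym (binarySeq-runΦ v runΦ-v)))

cfDigits-reverse : ∀ {p p̃ q} → InFareyTree p q → InFareyTree p̃ q →
  binarySeq p̃ q ∷ʳ b1 ≡ reverse (binarySeq p q ∷ʳ b1) → cfDigits p̃ q ≡ reverse (cfDigits p q)
cfDigits-reverse {p} {p̃} {q} p/q p̃/q seq≡ =
  blocks-injective (positive p̃/q) (All-reverse (positive p/q)) (∷ʳ-injectiveˡ _ _ (begin
    concatMap block (cfDigits p̃ q) ∷ʳ b0        ≡⟨ cong (_∷ʳ b0) (blocks-cfDigits p̃/q) ⟩
    b0 ∷ (binarySeq p̃ q ∷ʳ b1) ∷ʳ b0            ≡⟨ cong (λ u → b0 ∷ u ∷ʳ b0) seq≡ ⟩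
    b0 ∷ reverse (binarySeq p q ∷ʳ b1) ∷ʳ b0    ≡⟨ cong (b0 ∷_) (sym (unfold-reverse b0 (binarySeq p q ∷ʳ b1))) ⟩
    b0 ∷ reverse (b0 ∷ binarySeq p q ∷ʳ b1)     ≡⟨ sym (reverse-∷ʳ (b0 ∷ binarySeq p q ∷ʳ b1) b0) ⟩
    reverse ((b0 ∷ binarySeq p q ∷ʳ b1) ∷ʳ b0)  ≡⟨ cong (λ u → reverse (u ∷ʳ b0)) (sym (blocks-cfDigits p/q)) ⟩
    reverse (concatMap block (cfDigits p q) ∷ʳ b0) ≡⟨ reverse-blocks (cfDigits p q) ⟩
    concatMap block (reverse (cfDigits p q)) ∷ʳ b0 ∎))
  where
  open ≡-Reasoning
  positive : ∀ {p q} → InFareyTree p q → All (1 ≤_) (cfDigits p q)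
  positive {p} {q} p/q = cfD-positive q p q (<⇒≤ (InFareyTree.p<q p/q))

theorem4p7 : (n r : ℕ) → 2 ≤ n → 1 ≤ r → 2 * r < n → gcd r n ≡ 1 →
    (m n₁ n₂ k₁ k₂ t s : ℕ) → 1 ≤ m → m ≤ length (binarySeq r n) →
    prodΦ (take m (binarySeq r n)) ≡ mat t s k₂ k₁ →
    act (mat t s k₂ k₁) (n₂ , n₁) ≡ (r , n) →
    Σ ℕ (λ r̃ →
      gcd r̃ n ≡ 1
      × binarySeq r̃ n ≡ b1 ∷ reverse (drop 1 (binarySeq r n))
      × Σ ℕ (λ t̃ → Σ ℕ (λ s̃ → Σ ℕ (λ k̃₂ →
          k̃₂ + n₂ ≡ n₁
          × prodΦ (take (length (binarySeq r n) + 1 ∸ m) (b1 ∷ reverse (drop 1 (binarySeq r n)))) ≡ mat t̃ s̃ k̃₂ n₂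
          × act (mat t̃ s̃ k̃₂ n₂) (k₁ , k₁ + k₂) ≡ (r̃ , n))))
      × cfDigits r̃ n ≡ reverse (cfDigits r n))
theorem4p7 n r _ 1≤r 2r<n gcd≡1 m n₁ n₂ k₁ k₂ t s 1≤m m≤ℓ prodA actA =
  r̃ , coprime⇒gcd≡1 (InFareyTree.coprime r̃/n) , binarySeq-r̃ ,
  conjugate-generation w m 1≤m m≤ℓ (runΦ-binarySeq r/n) reversed-run prodA actA ,
  cfDigits-reverse r/n r̃/n (trans (cong (_∷ʳ b1) binarySeq-r̃) (sym (reverse-extended 2r<n)))
  where
  r/n : InFareyTree r n
  r/n = fraction 1≤r (≤-trans (s≤s (m≤m+n r (r + 0))) 2r<n) (gcd≡1⇒coprime gcd≡1)
  w w̃ : List Bit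
  w = binarySeq r n
  w̃ = b1 ∷ reverse (drop 1 w)
  r̃ : ℕ
  r̃ = proj₁ (runΦ w̃ (1 , 2))
  runΦ-w̃ : runΦ w̃ (1 , 2) ≡ (r̃ , n)
  runΦ-w̃ = cong (r̃ ,_) (reversed-denominator r/n 2r<n)
  reversed-run : runΦ (reverse (w ∷ʳ b1)) (1 , 1) ≡ (r̃ , n)
  reversed-run = trans (cong (λ u → runΦ u (1 , 1)) (reverse-extended 2r<n)) (trans (runΦ-∷ʳ-b1 w̃) runΦ-w̃)
  r̃/n : InFareyTree r̃ n
  r̃/n = subst (uncurry InFareyTree) runΦ-w̃ (runΦ-inFareyTree w̃)
  binarySeq-r̃ : binarySeq r̃ n ≡ w̃
  binarySeq-r̃ = binarySeq-runΦ w̃ runΦ-w̃
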